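{- Let $\Phi_1$ and $\Phi_2$ be MMSNP $\tau$-sentences in normal form. If there is a recolouring from $\Phi_1$ to $\Phi_2$, then every $\tau$-structure that satisfies $\Phi_1$ also satisfies $\Phi_2$.
   Context: $\tau$ finite relational signature. MMSNP $\tau$-sentence: $\exists P_1,\dots,P_n\forall\bar x\bigwedge_i\neg(\alpha_i\wedge\beta_i)$ with $P_j$ unary symbols not in $\tau$, $\alpha_i$ a conjunction of atomic $\tau$-formulas (no equality), $\beta_i$ a conjunction of atomic or negated atomic formulas in the $P_j$. A conjunction of atomic formulas is connected if its conjuncts cannot be split into two non-empty sets with disjoint variables; biconnected if connected and not splittable into two non-empty sets sharing exactly one variable. Normal form (colours $\sigma=\{M_1,\dots,M_n\}$, $n\ge1$): each $\alpha_i$ connected; (1) first conjunct $\neg(\neg M_1(x)\wedge\cdots\wedge\neg M_n(x))$; (2) contains $\neg(M_i(x)\wedge M_j(x))$ for distinct $i,j$; (3) every variable of every conjunct other than the first occurs in a literal $M_i(x)$ of that conjunct; (4) conjuncts not of form (1),(2) are biconnected; (5) for every $k$, a $(\tau\cup\sigma)$-structure with at most $k$ elements satisfies the first-order part of $\Phi$ if it satisfies all conjuncts with at most $k$ variables. Convention: conjuncts other than the first are $\neg\phi$ with $\phi$ a conjunction of atomic $(\tau\cup\sigma)$-formulas. The coloured obstructions of $\Phi$ are the canonical databases (elements = variables, relations = atoms) of all such $\phi$. If $\Phi_1,\Phi_2$ are in normal form with colour sets $\sigma_1,\sigma_2$, for $r\colon\sigma_1\to\sigma_2$ and a $(\tau\cup\sigma_1)$-structure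 ${\mathfrak A}$, $r({\mathfrak A})$ is the $(\tau\cup\sigma_2)$-structure obtained by renaming each $P\in\sigma_1$ to $r(P)$ (interpreting each $Q\in\sigma_2$ as the union of the $P$ with $r(P)=Q$). A recolouring from $\Phi_1$ to $\Phi_2$ is a map $r\colon\sigma_1\to\sigma_2$ such that for every $(\tau\cup\sigma_1)$-structure ${\mathfrak A}$, if some coloured obstruction of $\Phi_2$ homomorphically maps to $r({\mathfrak A})$, then some coloured obstruction of $\Phi_1$ homomorphically maps to ${\mathfrak A}$. -}

module Defs where

open import Data.Nat using (ℕ; zero; suc; _≤_)
open import Data.Fin using (Fin; zero; suc)
open import Data.Bool using (Bool; true; false)
open import Data.Vec using (Vec)
import Data.Vec as Vec
import Data.Vec.Membership.Propositional as VecMem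
open import Data.List using (List; []; _∷_; drop; allFin; length; lookup)
import Data.List as List
open import Data.List.Membership.Propositional using (_∈_)
open import Data.List.Relation.Unary.All using (All)
open import Data.Product using (Σ; _×_; _,_; ∃; ∃-syntax)
open import Data.Sum using (_⊎_)
open import Relation.Nullary using (¬_)
open import Relation.Binary.PropositionalEquality using (_≡_; _≢_)
open import Function.Definitions using (Injective)

record Signature : Set where
  field
    nrel  : ℕ
    arity : Fin nrel → ℕ
open Signature public

record Structure (τ : Signature) : Set₁ where
  field
    Carrier : Set
    rel     : (R : Fin (nrel τ)) → Vec Carrier (arity τ R) → Set
open Structure public

-- A (τ ∪ σ)-structure where σ = {M₀,…,M_{n-1}} are n unary colour symbols.
record ColStructure (τ : Signature) (n : ℕ) : Set₁ where
  field
    CCarrier : Set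
    crel     : (R : Fin (nrel τ)) → Vec CCarrier (arity τ R) → Set
    col      : Fin n → CCarrier → Set
open ColStructure public

expand : {τ : Signature} {n : ℕ} (A : Structure τ) →
         (Fin n → Carrier A → Set) → ColStructure τ n
expand A P = record { CCarrier = Carrier A ; crel = rel A ; col = P }

Hom : {τ : Signature} {n : ℕ} → ColStructure τ n → ColStructure τ n → Set
Hom {τ} {n} B C =
  Σ (CCarrier B → CCarrier C) λ h →
    (∀ (R : Fin (nrel τ)) (t : Vec (CCarrier B) (arity τ R)) →
        crel B R t → crel C R (Vec.map h t))
  × (∀ (j : Fin n) (a : CCarrier B) → col B j a → col C j (h a))

AtMost : ℕ → Set → Set
AtMost k A = Σ (A → Fin k) Injective′
  where
  Injective′ : (A → Fin k) → Set
  Injective′ f = Injective _≡_ _≡_ f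

-- Atomic τ-formula over the variables Fin m (no equality).
Atom : Signature → ℕ → Set
Atom τ m = Σ (Fin (nrel τ)) λ R → Vec (Fin m) (arity τ R)

data Literal (n m : ℕ) : Set where
  pos : Fin n → Fin m → Literal n m
  neg : Fin n → Fin m → Literal n m

-- A conjunct ¬(α ∧ β) of the quantifier-free part, over variables Fin nvars:
-- α = conjunction of 'atoms', β = conjunction of 'lits'.
record Conjunct (τ : Signature) (n : ℕ) : Set where
  constructor conj
  field
    nvars : ℕ
    atoms : List (Atom τ nvars)
    lits  : List (Literal n nvars)
open Conjunct public

-- MMSNP τ-sentence  ∃ M₀ … M_{n-1} ∀ x̄ ⋀_i ¬(α_i ∧ β_i).
record MMSNP (τ : Signature) : Set where
  field
    ncol      : ℕ
    conjuncts : List (Conjunct τ ncol)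
open MMSNP public

LitHolds : {τ : Signature} {n m : ℕ} (B : ColStructure τ n) →
           (Fin m → CCarrier B) → Literal n m → Set
LitHolds B s (pos j x) = col B j (s x)
LitHolds B s (neg j x) = ¬ col B j (s x)

AtomHolds : {τ : Signature} {n m : ℕ} (B : ColStructure τ n) →
            (Fin m → CCarrier B) → Atom τ m → Set
AtomHolds B s (R , t) = crel B R (Vec.map s t)

Holds : {τ : Signature} {n : ℕ} (B : ColStructure τ n) (c : Conjunct τ n) →
        (Fin (nvars c) → CCarrier B) → Set
Holds B c s = All (AtomHolds B s) (atoms c) × All (LitHolds B s) (lits c)

SatConj : {τ : Signature} {n : ℕ} → ColStructure τ n → Conjunct τ n → Set
SatConj B c = ∀ (s : Fin (nvars c) → CCarrier B) → ¬ Holds B c s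

SatFO : {τ : Signature} (Φ : MMSNP τ) → ColStructure τ (ncol Φ) → Set
SatFO Φ B = All (SatConj B) (conjuncts Φ)

_⊨_ : {τ : Signature} → Structure τ → MMSNP τ → Set₁
A ⊨ Φ = Σ (Fin (ncol Φ) → Carrier A → Set) λ M → SatFO Φ (expand A M)

module _ {τ : Signature} {m : ℕ} where

  OccursIn : Fin m → Atom τ m → Set
  OccursIn x (R , t) = x VecMem.∈ t

  Shared : (as : List (Atom τ m)) → (Fin (length as) → Bool) → Fin m → Set
  Shared as p x =
    (∃[ i ] (p i ≡ true  × OccursIn x (lookup as i))) ×
    (∃[ i ] (p i ≡ false × OccursIn x (lookup as i)))

  NonTrivialSplit : (as : List (Atom τ m)) → (Fin (length as) → Bool) → Set
  NonTrivialSplit as p = (∃[ i ] p i ≡ true) × (∃[ i ] p i ≡ false)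

  Connected : List (Atom τ m) → Set
  Connected as =
    ¬ (Σ (Fin (length as) → Bool) λ p →
         NonTrivialSplit as p × (∀ x → ¬ Shared as p x))

  Biconnected : List (Atom τ m) → Set
  Biconnected as =
    Connected as ×
    ¬ (Σ (Fin (length as) → Bool) λ p →
         NonTrivialSplit as p ×
         (∃[ x ] (Shared as p x × (∀ y → Shared as p y → y ≡ x))))

form1 : (τ : Signature) (n : ℕ) → Conjunct τ n
form1 τ n = conj 1 [] (List.map (λ j → neg j zero) (allFin n))

form2 : (τ : Signature) {n : ℕ} → Fin n → Fin n → Conjunct τ n
form2 τ i j = conj 1 [] (pos i zero ∷ pos j zero ∷ [])

otherConjuncts : {τ : Signature} (Φ : MMSNP τ) → List (Conjunct τ (ncol Φ))
otherConjuncts Φ = drop 1 (conjuncts Φ)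

record NormalForm {τ : Signature} (Φ : MMSNP τ) : Set₁ where
  field
    atLeastOneColour : 1 ≤ ncol Φ
    connected : All (λ c → Connected (atoms c)) (conjuncts Φ)
    firstConj : Σ (List (Conjunct τ (ncol Φ))) λ rest →
                  conjuncts Φ ≡ form1 τ (ncol Φ) ∷ rest
    exclusive : ∀ (i j : Fin (ncol Φ)) → i ≢ j →
                  (form2 τ i j ∈ conjuncts Φ) ⊎ (form2 τ j i ∈ conjuncts Φ)
    -- convention: conjuncts other than the first are ¬φ with φ a conjunction
    -- of atomic (τ ∪ σ)-formulas (no negated colour literals)
    positive : All (λ c → All (λ l → ∃[ j ] ∃[ x ] (l ≡ pos j x)) (lits c))
                   (otherConjuncts Φ)
    coloured : All (λ c → ∀ (x : Fin (nvars c)) → ∃[ j ] (pos j x ∈ lits c))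
                   (otherConjuncts Φ)
    biconnected : All (λ c → (c ≡ form1 τ (ncol Φ))
                             ⊎ (∃[ i ] ∃[ j ] (i ≢ j × c ≡ form2 τ i j))
                             ⊎ Biconnected (atoms c))
                      (conjuncts Φ)
    smallConj : ∀ (k : ℕ) (B : ColStructure τ (ncol Φ)) → AtMost k (CCarrier B) →
                  All (λ c → nvars c ≤ k → SatConj B c) (conjuncts Φ) →
                  SatFO Φ B

canonicalDB : {τ : Signature} {n : ℕ} → Conjunct τ n → ColStructure τ n
canonicalDB c = record
  { CCarrier = Fin (nvars c)
  ; crel     = λ R t → (R , t) ∈ atoms c
  ; col      = λ j x → pos j x ∈ lits c
  }

ObstructionMapsTo : {τ : Signature} (Φ : MMSNP τ) → ColStructure τ (ncol Φ) → Set
ObstructionMapsTo Φ B =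
  ∃[ c ] (c ∈ otherConjuncts Φ × Hom (canonicalDB c) B)

recolour : {τ : Signature} {n₁ n₂ : ℕ} → (Fin n₁ → Fin n₂) →
           ColStructure τ n₁ → ColStructure τ n₂
recolour {n₁ = n₁} r A = record
  { CCarrier = CCarrier A
  ; crel     = crel A
  ; col      = λ Q a → Σ (Fin n₁) λ P → (r P ≡ Q) × col A P a
  }

IsRecolouring : {τ : Signature} (Φ₁ Φ₂ : MMSNP τ) →
                (Fin (ncol Φ₁) → Fin (ncol Φ₂)) → Set₁
IsRecolouring {τ} Φ₁ Φ₂ r =
  ∀ (A : ColStructure τ (ncol Φ₁)) →
    ObstructionMapsTo Φ₂ (recolour r A) → ObstructionMapsTo Φ₁ A

-- A colouring M witnessing A ⊨ Φ₁ is pushed along the recolouring r to the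
-- colouring Q ↦ ⋃_{r P = Q} M P.  This union covers every element because M
-- does, and since Φ₂ is in normal form every other conjunct of Φ₂ is violated
-- exactly when one of its coloured obstructions maps to the recoloured
-- structure; the recolouring property pulls such a map back to an
-- obstruction of Φ₁, which cannot map to a model of Φ₁.
module Submission where

open import Defs
open import Data.Nat using (ℕ)
open import Data.Fin using (Fin; zero)
open import Data.Product using (Σ; ∃-syntax; _,_; proj₁; proj₂)
open import Data.List using (_∷_; allFin)
import Data.List as List
open import Data.List.Relation.Unary.All as All using (All; _∷_)
open import Data.List.Relation.Unary.All.Properties using (drop⁺)
open import Data.List.Membership.Propositional using (_∈_)
open import Data.List.Membership.Propositional.Properties
  using (∈-map⁺; ∈-map⁻; ∈-allFin)
open import Relation.Nullary using (¬_)
open import Relation.Binary.PropositionalEquality using (_≡_; refl; sym; subst)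

module _ {τ : Signature} {n : ℕ} where

  PositiveLits : Conjunct τ n → Set
  PositiveLits c = All (λ l → ∃[ j ] ∃[ x ] (l ≡ pos j x)) (lits c)

  holds⇒hom : (B : ColStructure τ n) (c : Conjunct τ n)
              (s : Fin (nvars c) → CCarrier B) →
              Holds B c s → Hom (canonicalDB c) B
  holds⇒hom B c s (atomsHold , litsHold) =
    s , (λ R t at → All.lookup atomsHold at) , (λ j x lit → All.lookup litsHold lit)

  hom⇒holds : (B : ColStructure τ n) (c : Conjunct τ n) → PositiveLits c →
              (h : Hom (canonicalDB c) B) → Holds B c (proj₁ h)
  hom⇒holds B c positive (s , relHom , colHom) =
    All.tabulate (λ { {R , t} at → relHom R t at }) , All.tabulate posHolds
    where
    posHolds : ∀ {l} → l ∈ lits c → LitHolds B s l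
    posHolds lit with All.lookup positive lit
    ... | j , x , refl = colHom j x lit

-- Every element of r(B) keeps a colour, namely the image of one it has in B.
recolour-form1 : {τ : Signature} {n₁ n₂ : ℕ} (r : Fin n₁ → Fin n₂)
                 (B : ColStructure τ n₁) →
                 SatConj B (form1 τ n₁) → SatConj (recolour r B) (form1 τ n₂)
recolour-form1 {τ} {n₁} r B covered s (_ , uncoloured') =
  covered s (All.[] , All.tabulate uncoloured)
  where
  uncoloured : ∀ {l} → l ∈ List.map (λ j → neg j zero) (allFin n₁) → LitHolds B s l
  uncoloured l∈ with ∈-map⁻ (λ j → neg j zero) l∈
  ... | P , _ , refl = λ sP →
    All.lookup uncoloured' (∈-map⁺ (λ j → neg j zero) (∈-allFin (r P))) (P , refl , sP)

module _ {τ : Signature} (Φ : MMSNP τ) {B : ColStructure τ (ncol Φ)} where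

  satFO⇒¬obstruction : All PositiveLits (otherConjuncts Φ) →
                       SatFO Φ B → ¬ ObstructionMapsTo Φ B
  satFO⇒¬obstruction positive sat (c , c∈ , h) =
    All.lookup (drop⁺ 1 sat) c∈ (proj₁ h)
      (hom⇒holds B c (All.lookup positive c∈) h)

  satFO⇒firstConj : ∀ {c rest} → conjuncts Φ ≡ c ∷ rest →
                    SatFO Φ B → SatConj B c
  satFO⇒firstConj eq sat = All.head (subst (All (SatConj B)) eq sat)

  firstConj∧¬obstruction⇒satFO : ∀ {c rest} → conjuncts Φ ≡ c ∷ rest →
                                 SatConj B c → ¬ ObstructionMapsTo Φ B →
                                 SatFO Φ B
  firstConj∧¬obstruction⇒satFO {c} {rest} eq satFirst noObstruction =
    subst (All (SatConj B)) (sym eq) (satFirst ∷ All.tabulate satOther)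
    where
    satOther : ∀ {d} → d ∈ rest → SatConj B d
    satOther {d} d∈ s holds =
      noObstruction
        (d , subst (λ cs → d ∈ List.drop 1 cs) (sym eq) d∈ , holds⇒hom B d s holds)

lemma3p25 : (τ : Signature) (Φ₁ Φ₂ : MMSNP τ) →
    NormalForm Φ₁ → NormalForm Φ₂ →
    Σ (Fin (ncol Φ₁) → Fin (ncol Φ₂)) (IsRecolouring Φ₁ Φ₂) →
    ∀ (A : Structure τ) → A ⊨ Φ₁ → A ⊨ Φ₂
lemma3p25 τ Φ₁ Φ₂ NF₁ NF₂ (r , isRecolouring) A (M , sat) =
  col B′ , firstConj∧¬obstruction⇒satFO Φ₂ firstConj₂ B′-covered B′-obstructionFree
  where
  firstConj₁ : conjuncts Φ₁ ≡ form1 τ (ncol Φ₁) ∷ proj₁ (NormalForm.firstConj NF₁)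
  firstConj₁ = proj₂ (NormalForm.firstConj NF₁)

  firstConj₂ : conjuncts Φ₂ ≡ form1 τ (ncol Φ₂) ∷ proj₁ (NormalForm.firstConj NF₂)
  firstConj₂ = proj₂ (NormalForm.firstConj NF₂)

  B : ColStructure τ (ncol Φ₁)
  B = expand A M

  B′ : ColStructure τ (ncol Φ₂)
  B′ = recolour r B

  B′-covered : SatConj B′ (form1 τ (ncol Φ₂))
  B′-covered = recolour-form1 r B (satFO⇒firstConj Φ₁ firstConj₁ sat)

  B′-obstructionFree : ¬ ObstructionMapsTo Φ₂ B′
  B′-obstructionFree obstruction =
    satFO⇒¬obstruction Φ₁ (NormalForm.positive NF₁) sat (isRecolouring B obstruction)
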